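{- For every formal monomial $m\in M_n$, the two-colored graph $\mathscr{G}(m)$ is a tree belonging to $\overline{\mathcal{G}}_n$, and its root (as an element of $\overline{\mathcal{G}}_n$) is $\operatorname{gr}(m)$.
   Context: Let $X=\{x_1<\dots<x_n\}$. $M_n$ is the set of formal complete bracketings of the letters of $X$, each letter used exactly once, using two binary operations $[\cdot,\cdot]$ and $\langle\cdot,\cdot\rangle$ (no relations imposed). The graphical root is defined by $\operatorname{gr}(x)=x$ for a letter, $\operatorname{gr}([m_1,m_2])=\min(\operatorname{gr}(m_1),\operatorname{gr}(m_2))$, $\operatorname{gr}(\langle m_1,m_2\rangle)=\max(\operatorname{gr}(m_1),\operatorname{gr}(m_2))$. The graph $\mathscr{G}(m)$ on the letters of $m$ is defined by $\mathscr{G}(x)=x$ and, for $m=\{m_1,m_2\}$, $\mathscr{G}(m)$ is the union of $\mathscr{G}(m_1)$ and $\mathscr{G}(m_2)$ plus an edge $\{\operatorname{gr}(m_1),\operatorname{gr}(m_2)\}$ colored red if $\{\cdot,\cdot\}=[\cdot,\cdot]$ and blue if $\{\cdot,\cdot\}=\langle\cdot,\cdot\rangle$. $\overline{\mathcal{G}}_n$ is the set of trees on vertex set $X$ with edges colored red or blue avoiding: (1) $i<j<k$ with $\{i,k\},\{j,k\}$ both red; (2) $i<j<k$ with $\{i,j\},\{i,k\}$ both blue; (3) $i<j<k$ with $\{i,j\}$ red and $\{j,k\}$ blue. The root of $G\in\overline{\mathcal{G}}_n$ is defined as follows: orient each red edge $\{i,j\}$ with $i<j$ as $i\to j$ and each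 blue edge $\{i,j\}$ with $i<j$ as $j\to i$; the root is the unique vertex with no incoming edge (equivalently, $G$ is the image of a unique rooted tree under the map coloring parent-child edges red if parent $<$ child and blue otherwise, and its root is that rooted tree's root). -}

module Defs where

open import Data.Nat using (ℕ)
open import Data.Fin using (Fin; _<_; _≤?_)
open import Data.List using (List; []; _∷_; _++_; length; lookup; removeAt; allFin)
open import Data.List.Membership.Propositional using (_∈_)
open import Data.List.Relation.Binary.Permutation.Propositional using (_↭_)
open import Data.Product using (Σ; _×_; _,_; ∃; ∃-syntax)
open import Data.Sum using (_⊎_)
open import Relation.Nullary using (¬_; yes; no)
open import Relation.Binary.PropositionalEquality using (_≡_)

-- Letters x_1 < ... < x_n are represented by Fin n with its natural order.

-- The two binary operations: [_,_] (bracket) and ⟨_,_⟩ (angle).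
data Op : Set where
  bracket angle : Op

data Term (n : ℕ) : Set where
  leaf : Fin n → Term n
  node : Op → Term n → Term n → Term n

letters : ∀ {n} → Term n → List (Fin n)
letters (leaf x) = x ∷ []
letters (node _ a b) = letters a ++ letters b

InM : ∀ n → Term n → Set
InM n m = letters m ↭ allFin n

minF maxF : ∀ {n} → Fin n → Fin n → Fin n
minF i j with i ≤? j
... | yes _ = i
... | no  _ = j
maxF i j with i ≤? j
... | yes _ = j
... | no  _ = i

gr : ∀ {n} → Term n → Fin n
gr (leaf x) = x
gr (node bracket a b) = minF (gr a) (gr b)
gr (node angle a b) = maxF (gr a) (gr b)

data Colour : Set where
  red blue : Colour

record Edge (n : ℕ) : Set where
  constructor edge
  field
    colour : Colour
    end₁   : Fin n
    end₂   : Fin n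

colourOf : Op → Colour
colourOf bracket = red
colourOf angle = blue

-- The graph 𝒢(m), as its list of (undirected, coloured) edges;
-- vertex set is always all of Fin n.
graphEdges : ∀ {n} → Term n → List (Edge n)
graphEdges (leaf x) = []
graphEdges (node o a b) =
  graphEdges a ++ graphEdges b ++ (edge (colourOf o) (gr a) (gr b) ∷ [])

HasEdge : ∀ {n} → List (Edge n) → Colour → Fin n → Fin n → Set
HasEdge E c i j = edge c i j ∈ E ⊎ edge c j i ∈ E

data Reach {n : ℕ} (E : List (Edge n)) : Fin n → Fin n → Set where
  here : ∀ {u} → Reach E u u
  step : ∀ {c u v w} → HasEdge E c u v → Reach E v w → Reach E u w

Connected : ∀ {n} → List (Edge n) → Set
Connected {n} E = (u v : Fin n) → Reach E u v

-- acyclic: every edge is a bridge, i.e. after deleting it its endpoints are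
-- no longer connected (this also excludes loops and multiple edges)
Acyclic : ∀ {n} → List (Edge n) → Set
Acyclic E = (k : Fin (length E)) →
  ¬ Reach (removeAt E k) (Edge.end₁ (lookup E k)) (Edge.end₂ (lookup E k))

IsTree : ∀ {n} → List (Edge n) → Set
IsTree E = Connected E × Acyclic E

AvoidsPatterns : ∀ {n} → List (Edge n) → Set
AvoidsPatterns {n} E =
    (¬ Σ (Fin n) λ i → Σ (Fin n) λ j → Σ (Fin n) λ k →
        i < j × j < k × HasEdge E red i k × HasEdge E red j k)
  × (¬ Σ (Fin n) λ i → Σ (Fin n) λ j → Σ (Fin n) λ k →
        i < j × j < k × HasEdge E blue i j × HasEdge E blue i k)
  × (¬ Σ (Fin n) λ i → Σ (Fin n) λ j → Σ (Fin n) λ k →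
        i < j × j < k × HasEdge E red i j × HasEdge E blue j k)

InGbar : ∀ {n} → List (Edge n) → Set
InGbar E = IsTree E × AvoidsPatterns E

-- orientation: red {i,j}, i<j, is i → j; blue {i,j}, i<j, is j → i.
-- v has an incoming edge from u:
Incoming : ∀ {n} → List (Edge n) → Fin n → Set
Incoming {n} E v = Σ (Fin n) λ u →
  (HasEdge E red u v × u < v) ⊎ (HasEdge E blue u v × v < u)

IsRoot : ∀ {n} → List (Edge n) → Fin n → Set
IsRoot {n} E r = ¬ Incoming E r × ((v : Fin n) → ¬ Incoming E v → v ≡ r)

-- Orient every edge of 𝒢(m) as in the definition of the root: a red edge points to its larger
-- end, a blue edge to its smaller end.  The new edge {gr m₁, gr m₂} of m = {m₁, m₂} then points
-- away from gr m, since gr m is the smaller (red) or larger (blue) of its two ends.  By induction,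
-- gr m has no incoming arc and every other letter has exactly one, and each forbidden pattern
-- (1)–(3) exhibits a vertex with two incoming arcs.  The letters of m₁ and m₂ are disjoint,
-- so 𝒢(m) is two trees joined by one edge between them, which is again a tree.

module Submission where

open import Defs
open import Data.Nat using (ℕ)
open import Data.Product using (_×_; Σ; ∃; _,_; proj₁; proj₂; map₂)

import Data.Nat.Properties as ℕₚ
open import Data.Fin using (Fin; zero; suc; _≤_; _<_; _≤?_; _≟_)
open import Data.Fin.Properties using (<-irrefl; <-asym; <-trans; ≤∧≢⇒<)
open import Data.List using (List; []; _∷_; _++_; lookup; removeAt)
open import Data.List.Properties using (++-identityʳ)
open import Data.List.Membership.Propositional using (_∈_; _∉_)
open import Data.List.Membership.Propositional.Properties
  using (∈-++⁻; ∈-++⁺ˡ; ∈-++⁺ʳ; ∈-allFin; ∈-lookup)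
import Data.List.Membership.DecPropositional as DecMembership
open import Data.List.Relation.Unary.Any using (here; there)
open import Data.List.Relation.Unary.All as All using (All; []; _∷_)
open import Data.List.Relation.Unary.All.Properties as All using ()
open import Data.List.Relation.Unary.Unique.Propositional using (Unique; []; _∷_)
open import Data.List.Relation.Unary.Unique.Propositional.Properties using (allFin⁺)
open import Data.List.Relation.Binary.Disjoint.Propositional using (Disjoint)
open import Data.List.Relation.Binary.Subset.Propositional using (_⊆_)
open import Data.List.Relation.Binary.Subset.Propositional.Properties using (xs⊆xs++ys; xs⊆ys++xs)
open import Data.List.Relation.Binary.Permutation.Propositional using (↭-sym; ↭⇒↭ₛ)
open import Data.List.Relation.Binary.Permutation.Propositional.Properties using (∈-resp-↭)
open import Data.List.Relation.Binary.Permutation.Setoid.Properties using (Unique-resp-↭)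
open import Data.Sum using (_⊎_; inj₁; inj₂)
open import Data.Unit using (⊤; tt)
open import Data.Empty using (⊥-elim)
open import Function using (_∘_)
open import Relation.Nullary using (¬_; yes; no; contradiction)
open import Relation.Nullary.Decidable using (¬?; decidable-stable)
open import Level using (0ℓ)
open import Relation.Unary using (Pred; Decidable)
open import Relation.Binary.PropositionalEquality

open Edge using (end₁; end₂)

module _ {a} {A : Set a} where

  Unique-++⁻ : ∀ xs {ys : List A} → Unique (xs ++ ys) → Unique xs × Unique ys × Disjoint xs ys
  Unique-++⁻ [] ys! = [] , ys! , λ { (() , _) }
  Unique-++⁻ (x ∷ xs) (x∉xs++ys ∷ xs++ys!) with Unique-++⁻ xs xs++ys!
  ... | xs! , ys! , xs#ys = All.++⁻ˡ xs x∉xs++ys ∷ xs! , ys! , λ where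
    (here refl , v∈ys) → All.lookup (All.++⁻ʳ xs x∉xs++ys) v∈ys refl
    (there v∈xs , v∈ys) → xs#ys (v∈xs , v∈ys)

  removeAt-⊆ : ∀ (xs : List A) k → removeAt xs k ⊆ xs
  removeAt-⊆ (x ∷ xs) zero = there
  removeAt-⊆ (x ∷ xs) (suc k) (here refl) = here refl
  removeAt-⊆ (x ∷ xs) (suc k) (there v∈) = there (removeAt-⊆ xs k v∈)

  removeAt-++ : ∀ (xs ys : List A) k →
      (∃ λ k′ → removeAt (xs ++ ys) k ≡ removeAt xs k′ ++ ys × lookup (xs ++ ys) k ≡ lookup xs k′)
    ⊎ (∃ λ k′ → removeAt (xs ++ ys) k ≡ xs ++ removeAt ys k′ × lookup (xs ++ ys) k ≡ lookup ys k′)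
  removeAt-++ [] ys k = inj₂ (k , refl , refl)
  removeAt-++ (x ∷ xs) ys zero = inj₁ (zero , refl , refl)
  removeAt-++ (x ∷ xs) ys (suc k) with removeAt-++ xs ys k
  ... | inj₁ (k′ , p , q) = inj₁ (suc k′ , cong (x ∷_) p , q)
  ... | inj₂ (k′ , p , q) = inj₂ (k′ , cong (x ∷_) p , q)

module _ {n : ℕ} where

  open DecMembership (_≟_ {n}) using (_∈?_)

  private
    Graph = List (Edge n)

  record Inside (P : Pred (Fin n) 0ℓ) (e : Edge n) : Set where
    constructor _,_
    field
      end₁∈ : P (end₁ e)
      end₂∈ : P (end₂ e)

  Inside-map : ∀ {P Q : Pred (Fin n) 0ℓ} → (∀ {w} → P w → Q w) → ∀ {e} → Inside P e → Inside Q e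
  Inside-map P⇒Q (P₁ , P₂) = P⇒Q P₁ , P⇒Q P₂

  HasEdge-sym : ∀ {E : Graph} {c x y} → HasEdge E c x y → HasEdge E c y x
  HasEdge-sym (inj₁ e∈) = inj₂ e∈
  HasEdge-sym (inj₂ e∈) = inj₁ e∈

  HasEdge-⊆ : ∀ {E F : Graph} → E ⊆ F → ∀ {c x y} → HasEdge E c x y → HasEdge F c x y
  HasEdge-⊆ E⊆F (inj₁ e∈) = inj₁ (E⊆F e∈)
  HasEdge-⊆ E⊆F (inj₂ e∈) = inj₂ (E⊆F e∈)

  HasEdge-inside : ∀ {P : Pred (Fin n) 0ℓ} {E : Graph} → All (Inside P) E →
    ∀ {c x y} → HasEdge E c x y → P x × P y
  HasEdge-inside E⊆P (inj₁ e∈) = let (Px , Py) = All.lookup E⊆P e∈ in Px , Py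
  HasEdge-inside E⊆P (inj₂ e∈) = let (Py , Px) = All.lookup E⊆P e∈ in Px , Py

  HasEdge-++⁻ : ∀ (E : Graph) {F c x y} → HasEdge (E ++ F) c x y → HasEdge E c x y ⊎ HasEdge F c x y
  HasEdge-++⁻ E (inj₁ e∈) with ∈-++⁻ E e∈
  ... | inj₁ e∈E = inj₁ (inj₁ e∈E)
  ... | inj₂ e∈F = inj₂ (inj₁ e∈F)
  HasEdge-++⁻ E (inj₂ e∈) with ∈-++⁻ E e∈
  ... | inj₁ e∈E = inj₁ (inj₂ e∈E)
  ... | inj₂ e∈F = inj₂ (inj₂ e∈F)

  Reach-trans : ∀ {E : Graph} {x y z} → Reach E x y → Reach E y z → Reach E x z
  Reach-trans here r = r
  Reach-trans (step h r) r′ = step h (Reach-trans r r′)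

  Reach-map : ∀ {E F : Graph} (f : Fin n → Fin n) →
    (∀ {c x y} → edge c x y ∈ E → f x ≡ f y ⊎ HasEdge F c (f x) (f y)) →
    ∀ {u v} → Reach E u v → Reach F (f u) (f v)
  Reach-map f edge↦ here = here
  Reach-map {F = F} f edge↦ {v = v} (step (inj₁ e∈) r) with edge↦ e∈
  ... | inj₁ fu≡fw = subst (λ z → Reach F z (f v)) (sym fu≡fw) (Reach-map f edge↦ r)
  ... | inj₂ h = step h (Reach-map f edge↦ r)
  Reach-map {F = F} f edge↦ {v = v} (step (inj₂ e∈) r) with edge↦ e∈
  ... | inj₁ fw≡fu = subst (λ z → Reach F z (f v)) fw≡fu (Reach-map f edge↦ r)
  ... | inj₂ h = step (HasEdge-sym h) (Reach-map f edge↦ r)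

  Reach-⊆ : ∀ {E F : Graph} → E ⊆ F → ∀ {u v} → Reach E u v → Reach F u v
  Reach-⊆ E⊆F = Reach-map (λ w → w) (λ e∈ → inj₂ (inj₁ (E⊆F e∈)))

  Reach-closed : ∀ {P : Pred (Fin n) 0ℓ} {E : Graph} →
    (∀ {e} → e ∈ E → Inside P e ⊎ Inside (¬_ ∘ P) e) →
    ∀ {u v} → Reach E u v → P u → P v
  Reach-closed side here Pu = Pu
  Reach-closed side (step (inj₁ e∈) r) Pu with side e∈
  ... | inj₁ (_ , Pw) = Reach-closed side r Pw
  ... | inj₂ (¬Pu , _) = contradiction Pu ¬Pu
  Reach-closed side (step (inj₂ e∈) r) Pu with side e∈
  ... | inj₁ (Pw , _) = Reach-closed side r Pw
  ... | inj₂ (_ , ¬Pu) = contradiction Pu ¬Pu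

  -- A path between vertices of P survives the deletion of all edges that meet P at most in d:
  -- the retraction onto P sending every other vertex to d collapses exactly those edges.
  module _ {P : Pred (Fin n) 0ℓ} (P? : Decidable P) (d : Fin n) where

    retract : Fin n → Fin n
    retract w with P? w
    ... | yes _ = w
    ... | no _ = d

    retract-fixes : ∀ {w} → P w → retract w ≡ w
    retract-fixes {w} Pw with P? w
    ... | yes _ = refl
    ... | no ¬Pw = contradiction Pw ¬Pw

    retract-collapses : ∀ {w} → (P w → w ≡ d) → retract w ≡ d
    retract-collapses {w} Pw⇒w≡d with P? w
    ... | yes Pw = Pw⇒w≡d Pw
    ... | no _ = refl

    Reach-retract : ∀ {E F : Graph} →
      (∀ {e} → e ∈ E → (e ∈ F × Inside P e) ⊎ Inside (λ w → P w → w ≡ d) e) →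
      ∀ {u v} → Reach E u v → P u → P v → Reach F u v
    Reach-retract {F = F} side r Pu Pv =
      subst₂ (Reach F) (retract-fixes Pu) (retract-fixes Pv) (Reach-map retract edge↦ r)
      where
        edge↦ : ∀ {c x y} → edge c x y ∈ _ → retract x ≡ retract y ⊎ HasEdge F c (retract x) (retract y)
        edge↦ e∈ with side e∈
        ... | inj₁ (e∈F , Px , Py) =
          inj₂ (subst₂ (HasEdge F _) (sym (retract-fixes Px)) (sym (retract-fixes Py)) (inj₁ e∈F))
        ... | inj₂ (x↦d , y↦d) = inj₁ (trans (retract-collapses x↦d) (sym (retract-collapses y↦d)))

  module _ (S : List (Fin n)) {A B : Graph} {e : Edge n}
           (A⊆S : All (Inside (_∈ S)) A) (B#S : All (Inside (_∉ S)) B)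
           (e₁∈S : end₁ e ∈ S) (e₂∉S : end₂ e ∉ S) where

    Reach-join-insideˡ : ∀ {A′} → A′ ⊆ A →
      ∀ {x y} → Reach (A′ ++ B ++ e ∷ []) x y → x ∈ S → y ∈ S → Reach A′ x y
    Reach-join-insideˡ {A′} A′⊆A = Reach-retract (_∈? S) (end₁ e) side
      where
        side : ∀ {f} → f ∈ A′ ++ B ++ e ∷ [] →
          (f ∈ A′ × Inside (_∈ S) f) ⊎ Inside (λ w → w ∈ S → w ≡ end₁ e) f
        side f∈ with ∈-++⁻ A′ f∈
        ... | inj₁ f∈A′ = inj₁ (f∈A′ , All.lookup A⊆S (A′⊆A f∈A′))
        ... | inj₂ f∈B++e with ∈-++⁻ B f∈B++e
        ...   | inj₁ f∈B = let (f₁∉S , f₂∉S) = All.lookup B#S f∈B in inj₂ (⊥-elim ∘ f₁∉S , ⊥-elim ∘ f₂∉S)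
        ...   | inj₂ (here refl) = inj₂ ((λ _ → refl) , ⊥-elim ∘ e₂∉S)

    Reach-join-insideʳ : ∀ {B′} → B′ ⊆ B →
      ∀ {x y} → Reach (A ++ B′ ++ e ∷ []) x y → x ∉ S → y ∉ S → Reach B′ x y
    Reach-join-insideʳ {B′} B′⊆B = Reach-retract (λ w → ¬? (w ∈? S)) (end₂ e) side
      where
        side : ∀ {f} → f ∈ A ++ B′ ++ e ∷ [] →
          (f ∈ B′ × Inside (_∉ S) f) ⊎ Inside (λ w → w ∉ S → w ≡ end₂ e) f
        side f∈ with ∈-++⁻ A f∈
        ... | inj₁ f∈A = let (f₁∈S , f₂∈S) = All.lookup A⊆S f∈A in inj₂ (contradiction f₁∈S , contradiction f₂∈S)
        ... | inj₂ f∈B′++e with ∈-++⁻ B′ f∈B′++e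
        ...   | inj₁ f∈B′ = inj₁ (f∈B′ , All.lookup B#S (B′⊆B f∈B′))
        ...   | inj₂ (here refl) = inj₂ (contradiction e₁∈S , λ _ → refl)

    ¬Reach-join-crossing : ¬ Reach (A ++ B) (end₁ e) (end₂ e)
    ¬Reach-join-crossing r = e₂∉S (Reach-closed side r e₁∈S)
      where
        side : ∀ {f} → f ∈ A ++ B → Inside (_∈ S) f ⊎ Inside (_∉ S) f
        side f∈ with ∈-++⁻ A f∈
        ... | inj₁ f∈A = inj₁ (All.lookup A⊆S f∈A)
        ... | inj₂ f∈B = inj₂ (All.lookup B#S f∈B)

    Acyclic-join : Acyclic A → Acyclic B → Acyclic (A ++ B ++ e ∷ [])
    Acyclic-join acyclicA acyclicB k with removeAt-++ A (B ++ e ∷ []) k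
    ... | inj₁ (k′ , p , q) rewrite p | q =
      let (x∈S , y∈S) = All.lookup A⊆S (∈-lookup k′)
      in acyclicA k′ ∘ λ r → Reach-join-insideˡ (removeAt-⊆ A k′) r x∈S y∈S
    ... | inj₂ (k₁ , p₁ , q₁) with removeAt-++ B (e ∷ []) k₁
    ...   | inj₁ (k′ , p , q) rewrite p₁ | q₁ | p | q =
      let (x∉S , y∉S) = All.lookup B#S (∈-lookup k′)
      in acyclicB k′ ∘ λ r → Reach-join-insideʳ (removeAt-⊆ B k′) r x∉S y∉S
    ...   | inj₂ (zero , p , q) rewrite p₁ | q₁ | p | q | ++-identityʳ B = ¬Reach-join-crossing

  Oriented : Colour → Fin n → Fin n → Set
  Oriented red u v = u < v
  Oriented blue u v = v < u

  Oriented-irrefl : ∀ {c u v} → Oriented c u v → u ≢ v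
  Oriented-irrefl {red} u<v u≡v = <-irrefl u≡v u<v
  Oriented-irrefl {blue} v<u u≡v = <-irrefl (sym u≡v) v<u

  Oriented-asym : ∀ {c u v} → Oriented c u v → ¬ Oriented c v u
  Oriented-asym {red} = <-asym
  Oriented-asym {blue} = <-asym

  Arc : Graph → Fin n → Fin n → Set
  Arc E u v = Σ Colour λ c → HasEdge E c u v × Oriented c u v

  Arc-⊆ : ∀ {E F : Graph} → E ⊆ F → ∀ {u v} → Arc E u v → Arc F u v
  Arc-⊆ E⊆F (c , h , u→v) = c , HasEdge-⊆ E⊆F h , u→v

  Arc-++⁻ : ∀ (E : Graph) {F u v} → Arc (E ++ F) u v → Arc E u v ⊎ Arc F u v
  Arc-++⁻ E (c , h , u→v) with HasEdge-++⁻ E h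
  ... | inj₁ hᴱ = inj₁ (c , hᴱ , u→v)
  ... | inj₂ hᶠ = inj₂ (c , hᶠ , u→v)

  Arc-[] : ∀ {u v} → ¬ Arc [] u v
  Arc-[] (_ , inj₁ () , _)
  Arc-[] (_ , inj₂ () , _)

  Arc-irrefl : ∀ {E u v} → Arc E u v → u ≢ v
  Arc-irrefl (_ , _ , u→v) = Oriented-irrefl u→v

  Arc-target : ∀ {P : Pred (Fin n) 0ℓ} {E} → All (Inside P) E → ∀ {u v} → Arc E u v → P v
  Arc-target E⊆P (_ , h , _) = proj₂ (HasEdge-inside E⊆P h)

  Incoming⇒Arc : ∀ {E v} → Incoming E v → ∃ λ u → Arc E u v
  Incoming⇒Arc (u , inj₁ (h , u<v)) = u , red , h , u<v
  Incoming⇒Arc (u , inj₂ (h , v<u)) = u , blue , h , v<u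

  Arc⇒Incoming : ∀ {E u v} → Arc E u v → Incoming E v
  Arc⇒Incoming {u = u} (red , h , u<v) = u , inj₁ (h , u<v)
  Arc⇒Incoming {u = u} (blue , h , v<u) = u , inj₂ (h , v<u)

  SingleParent : Graph → Set
  SingleParent E = ∀ {u u′ v} → Arc E u v → Arc E u′ v → u ≡ u′

  singleParent⇒avoidsPatterns : ∀ {E} → SingleParent E → AvoidsPatterns E
  singleParent⇒avoidsPatterns single =
      (λ (i , j , k , i<j , j<k , ik , jk) →
         <-irrefl (single (red , ik , <-trans i<j j<k) (red , jk , j<k)) i<j)
    , (λ (i , j , k , i<j , j<k , ij , ik) →
         <-irrefl (single (blue , HasEdge-sym ij , i<j) (blue , HasEdge-sym ik , <-trans i<j j<k)) j<k)
    , (λ (i , j , k , i<j , j<k , ij , jk) →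
         <-irrefl (single (red , ij , i<j) (blue , HasEdge-sym jk , j<k)) (<-trans i<j j<k))

  isRoot : ∀ {E r} → (∀ {u} → ¬ Arc E u r) → (∀ v → v ≢ r → ∃ λ u → Arc E u v) → IsRoot E r
  isRoot {r = r} noArcInto arcInto =
      noArcInto ∘ proj₂ ∘ Incoming⇒Arc
    , λ v notIncoming → decidable-stable (v ≟ r) (notIncoming ∘ Arc⇒Incoming ∘ proj₂ ∘ arcInto v)

  minF-maxF-cases : (i j : Fin n) →
    (i ≤ j × minF i j ≡ i × maxF i j ≡ j) ⊎ (j < i × minF i j ≡ j × maxF i j ≡ i)
  minF-maxF-cases i j with i ≤? j
  ... | yes i≤j = inj₁ (i≤j , refl , refl)
  ... | no i≰j = inj₂ (ℕₚ.≰⇒> i≰j , refl , refl)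

  gr-node-≡ : ∀ o (a b : Term n) → gr (node o a b) ≡ gr a ⊎ gr (node o a b) ≡ gr b
  gr-node-≡ bracket a b with minF-maxF-cases (gr a) (gr b)
  ... | inj₁ (_ , min≡a , _) = inj₁ min≡a
  ... | inj₂ (_ , min≡b , _) = inj₂ min≡b
  gr-node-≡ angle a b with minF-maxF-cases (gr a) (gr b)
  ... | inj₁ (_ , _ , max≡b) = inj₂ max≡b
  ... | inj₂ (_ , _ , max≡a) = inj₁ max≡a

  gr-node-≢ˡ : ∀ o (a b : Term n) → gr (node o a b) ≢ gr a → Oriented (colourOf o) (gr b) (gr a)
  gr-node-≢ˡ bracket a b r≢a with minF-maxF-cases (gr a) (gr b)
  ... | inj₁ (_ , min≡a , _) = contradiction min≡a r≢a
  ... | inj₂ (b<a , _ , _) = b<a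
  gr-node-≢ˡ angle a b r≢a with minF-maxF-cases (gr a) (gr b)
  ... | inj₁ (a≤b , _ , max≡b) = ≤∧≢⇒< a≤b (r≢a ∘ trans max≡b ∘ sym)
  ... | inj₂ (_ , _ , max≡a) = contradiction max≡a r≢a

  gr-node-≢ʳ : ∀ o (a b : Term n) → gr (node o a b) ≢ gr b → Oriented (colourOf o) (gr a) (gr b)
  gr-node-≢ʳ bracket a b r≢b with minF-maxF-cases (gr a) (gr b)
  ... | inj₁ (a≤b , min≡a , _) = ≤∧≢⇒< a≤b (r≢b ∘ trans min≡a)
  ... | inj₂ (_ , min≡b , _) = contradiction min≡b r≢b
  gr-node-≢ʳ angle a b r≢b with minF-maxF-cases (gr a) (gr b)
  ... | inj₁ (_ , _ , max≡b) = contradiction max≡b r≢b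
  ... | inj₂ (b<a , _ , _) = b<a

  newEdge : Op → Term n → Term n → Edge n
  newEdge o a b = edge (colourOf o) (gr a) (gr b)

  newEdge-arc⁻ : ∀ o (a b : Term n) {u v} → Arc (newEdge o a b ∷ []) u v →
    u ≡ gr (node o a b) × (v ≡ gr a ⊎ v ≡ gr b)
  newEdge-arc⁻ o a b (_ , inj₁ (here refl) , a→b) with gr (node o a b) ≟ gr a
  ... | yes r≡a = sym r≡a , inj₂ refl
  ... | no r≢a = contradiction (gr-node-≢ˡ o a b r≢a) (Oriented-asym a→b)
  newEdge-arc⁻ o a b (_ , inj₂ (here refl) , b→a) with gr (node o a b) ≟ gr b
  ... | yes r≡b = sym r≡b , inj₁ refl
  ... | no r≢b = contradiction (gr-node-≢ʳ o a b r≢b) (Oriented-asym b→a)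

  newEdge-arc⁺ : ∀ o (a b : Term n) {v} → v ≡ gr a ⊎ v ≡ gr b → v ≢ gr (node o a b) →
    ∃ λ u → Arc (newEdge o a b ∷ []) u v
  newEdge-arc⁺ o a b (inj₁ refl) v≢r = gr b , colourOf o , inj₂ (here refl) , gr-node-≢ˡ o a b (v≢r ∘ sym)
  newEdge-arc⁺ o a b (inj₂ refl) v≢r = gr a , colourOf o , inj₁ (here refl) , gr-node-≢ʳ o a b (v≢r ∘ sym)

  Linear : Term n → Set
  Linear (leaf _) = ⊤
  Linear (node _ a b) = Linear a × Linear b × Disjoint (letters a) (letters b)

  unique⇒linear : ∀ t → Unique (letters t) → Linear t
  unique⇒linear (leaf _) _ = tt
  unique⇒linear (node _ a b) t! with Unique-++⁻ (letters a) t!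
  ... | a! , b! , a#b = unique⇒linear a a! , unique⇒linear b b! , a#b

  gr∈letters : ∀ t → gr t ∈ letters t
  gr∈letters (leaf _) = here refl
  gr∈letters (node o a b) with gr-node-≡ o a b
  ... | inj₁ r≡a rewrite r≡a = ∈-++⁺ˡ (gr∈letters a)
  ... | inj₂ r≡b rewrite r≡b = ∈-++⁺ʳ (letters a) (gr∈letters b)

  gr-node-∈ˡ : ∀ o {a b : Term n} → Disjoint (letters a) (letters b) →
    gr (node o a b) ∈ letters a → gr (node o a b) ≡ gr a
  gr-node-∈ˡ o {a} {b} a#b r∈a with gr-node-≡ o a b
  ... | inj₁ r≡a = r≡a
  ... | inj₂ r≡b = ⊥-elim (a#b (subst (_∈ letters a) r≡b r∈a , gr∈letters b))

  gr-node-∈ʳ : ∀ o {a b : Term n} → Disjoint (letters a) (letters b) →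
    gr (node o a b) ∈ letters b → gr (node o a b) ≡ gr b
  gr-node-∈ʳ o {a} {b} a#b r∈b with gr-node-≡ o a b
  ... | inj₁ r≡a = ⊥-elim (a#b (gr∈letters a , subst (_∈ letters b) r≡a r∈b))
  ... | inj₂ r≡b = r≡b

  graphEdges-inside : ∀ t → All (Inside (_∈ letters t)) (graphEdges t)
  graphEdges-inside (leaf _) = []
  graphEdges-inside (node o a b) =
    All.++⁺ (All.map (Inside-map ∈-++⁺ˡ) (graphEdges-inside a))
      (All.++⁺ (All.map (Inside-map (∈-++⁺ʳ (letters a))) (graphEdges-inside b))
        ((∈-++⁺ˡ (gr∈letters a) , ∈-++⁺ʳ (letters a) (gr∈letters b)) ∷ []))

  node-⊆ˡ : ∀ o (a b : Term n) → graphEdges a ⊆ graphEdges (node o a b)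
  node-⊆ˡ o a b = xs⊆xs++ys (graphEdges a) _

  node-⊆ʳ : ∀ o (a b : Term n) → graphEdges b ⊆ graphEdges (node o a b)
  node-⊆ʳ o a b = xs⊆ys++xs _ (graphEdges a) ∘ xs⊆xs++ys (graphEdges b) _

  node-⊆ᵉ : ∀ o (a b : Term n) → newEdge o a b ∷ [] ⊆ graphEdges (node o a b)
  node-⊆ᵉ o a b = xs⊆ys++xs _ (graphEdges a) ∘ xs⊆ys++xs _ (graphEdges b)

  Arc-node⁻ : ∀ o (a b : Term n) {u v} → Arc (graphEdges (node o a b)) u v →
    Arc (graphEdges a) u v ⊎ Arc (graphEdges b) u v ⊎ Arc (newEdge o a b ∷ []) u v
  Arc-node⁻ o a b arc with Arc-++⁻ (graphEdges a) arc
  ... | inj₁ arcᵃ = inj₁ arcᵃ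
  ... | inj₂ arc′ = inj₂ (Arc-++⁻ (graphEdges b) arc′)

  ¬Arc-into-gr : ∀ t → Linear t → ∀ {u} → ¬ Arc (graphEdges t) u (gr t)
  ¬Arc-into-gr (leaf _) _ = Arc-[]
  ¬Arc-into-gr (node o a b) (linear-a , linear-b , a#b) arc with Arc-node⁻ o a b arc
  ... | inj₁ arcᵃ = ¬Arc-into-gr a linear-a
        (subst (Arc _ _) (gr-node-∈ˡ o a#b (Arc-target (graphEdges-inside a) arcᵃ)) arcᵃ)
  ... | inj₂ (inj₁ arcᵇ) = ¬Arc-into-gr b linear-b
        (subst (Arc _ _) (gr-node-∈ʳ o a#b (Arc-target (graphEdges-inside b) arcᵇ)) arcᵇ)
  ... | inj₂ (inj₂ arcᵉ) = Arc-irrefl arcᵉ (proj₁ (newEdge-arc⁻ o a b arcᵉ))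

  graphEdges-singleParent : ∀ t → Linear t → SingleParent (graphEdges t)
  graphEdges-singleParent (leaf _) _ arc = ⊥-elim (Arc-[] arc)
  graphEdges-singleParent (node o a b) (linear-a , linear-b , a#b) arc arc′ =
    parents (Arc-node⁻ o a b arc) (Arc-node⁻ o a b arc′)
    where
      NodeArc : Fin n → Fin n → Set
      NodeArc u v = Arc (graphEdges a) u v ⊎ Arc (graphEdges b) u v ⊎ Arc (newEdge o a b ∷ []) u v

      target∈a : ∀ {u v} → Arc (graphEdges a) u v → v ∈ letters a
      target∈a = Arc-target (graphEdges-inside a)

      target∈b : ∀ {u v} → Arc (graphEdges b) u v → v ∈ letters b
      target∈b = Arc-target (graphEdges-inside b)

      missesᵃ : ∀ {u v} → Arc (graphEdges a) u v → ¬ (v ≡ gr a ⊎ v ≡ gr b)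
      missesᵃ arcᵃ (inj₁ refl) = ¬Arc-into-gr a linear-a arcᵃ
      missesᵃ arcᵃ (inj₂ refl) = a#b (target∈a arcᵃ , gr∈letters b)

      missesᵇ : ∀ {u v} → Arc (graphEdges b) u v → ¬ (v ≡ gr a ⊎ v ≡ gr b)
      missesᵇ arcᵇ (inj₁ refl) = a#b (gr∈letters a , target∈b arcᵇ)
      missesᵇ arcᵇ (inj₂ refl) = ¬Arc-into-gr b linear-b arcᵇ

      parents : ∀ {u u′ v} → NodeArc u v → NodeArc u′ v → u ≡ u′
      parents (inj₁ x) (inj₁ y) = graphEdges-singleParent a linear-a x y
      parents (inj₁ x) (inj₂ (inj₁ y)) = ⊥-elim (a#b (target∈a x , target∈b y))
      parents (inj₁ x) (inj₂ (inj₂ y)) = ⊥-elim (missesᵃ x (proj₂ (newEdge-arc⁻ o a b y)))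
      parents (inj₂ (inj₁ x)) (inj₁ y) = ⊥-elim (a#b (target∈a y , target∈b x))
      parents (inj₂ (inj₁ x)) (inj₂ (inj₁ y)) = graphEdges-singleParent b linear-b x y
      parents (inj₂ (inj₁ x)) (inj₂ (inj₂ y)) = ⊥-elim (missesᵇ x (proj₂ (newEdge-arc⁻ o a b y)))
      parents (inj₂ (inj₂ x)) (inj₁ y) = ⊥-elim (missesᵃ y (proj₂ (newEdge-arc⁻ o a b x)))
      parents (inj₂ (inj₂ x)) (inj₂ (inj₁ y)) = ⊥-elim (missesᵇ y (proj₂ (newEdge-arc⁻ o a b x)))
      parents (inj₂ (inj₂ x)) (inj₂ (inj₂ y)) =
        trans (proj₁ (newEdge-arc⁻ o a b x)) (sym (proj₁ (newEdge-arc⁻ o a b y)))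

  Arc-into-nonRoot : ∀ t → Linear t → ∀ {v} → v ∈ letters t → v ≢ gr t →
    ∃ λ u → Arc (graphEdges t) u v
  Arc-into-nonRoot (leaf _) _ (here refl) v≢r = contradiction refl v≢r
  Arc-into-nonRoot (node o a b) (linear-a , linear-b , _) {v} v∈ v≢r with ∈-++⁻ (letters a) v∈
  ... | inj₁ v∈a with v ≟ gr a
  ...   | no v≢a = map₂ (Arc-⊆ (node-⊆ˡ o a b)) (Arc-into-nonRoot a linear-a v∈a v≢a)
  ...   | yes v≡a = map₂ (Arc-⊆ (node-⊆ᵉ o a b)) (newEdge-arc⁺ o a b (inj₁ v≡a) v≢r)
  Arc-into-nonRoot (node o a b) (linear-a , linear-b , _) {v} v∈ v≢r | inj₂ v∈b with v ≟ gr b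
  ...   | no v≢b = map₂ (Arc-⊆ (node-⊆ʳ o a b)) (Arc-into-nonRoot b linear-b v∈b v≢b)
  ...   | yes v≡b = map₂ (Arc-⊆ (node-⊆ᵉ o a b)) (newEdge-arc⁺ o a b (inj₂ v≡b) v≢r)

  graphEdges-connected : ∀ t {u v} → u ∈ letters t → v ∈ letters t → Reach (graphEdges t) u v
  graphEdges-connected (leaf _) (here refl) (here refl) = here
  graphEdges-connected (node o a b) u∈ v∈ with ∈-++⁻ (letters a) u∈ | ∈-++⁻ (letters a) v∈
  ... | inj₁ u∈a | inj₁ v∈a = Reach-⊆ (node-⊆ˡ o a b) (graphEdges-connected a u∈a v∈a)
  ... | inj₂ u∈b | inj₂ v∈b = Reach-⊆ (node-⊆ʳ o a b) (graphEdges-connected b u∈b v∈b)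
  ... | inj₁ u∈a | inj₂ v∈b =
    Reach-trans (Reach-⊆ (node-⊆ˡ o a b) (graphEdges-connected a u∈a (gr∈letters a)))
      (step (inj₁ (node-⊆ᵉ o a b (here refl))) (Reach-⊆ (node-⊆ʳ o a b) (graphEdges-connected b (gr∈letters b) v∈b)))
  ... | inj₂ u∈b | inj₁ v∈a =
    Reach-trans (Reach-⊆ (node-⊆ʳ o a b) (graphEdges-connected b u∈b (gr∈letters b)))
      (step (inj₂ (node-⊆ᵉ o a b (here refl))) (Reach-⊆ (node-⊆ˡ o a b) (graphEdges-connected a (gr∈letters a) v∈a)))

  graphEdges-acyclic : ∀ t → Linear t → Acyclic (graphEdges t)
  graphEdges-acyclic (leaf _) _ ()
  graphEdges-acyclic (node o a b) (linear-a , linear-b , a#b) =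
    Acyclic-join (letters a) (graphEdges-inside a)
      (All.map (Inside-map (λ w∈b w∈a → a#b (w∈a , w∈b))) (graphEdges-inside b))
      (gr∈letters a) (λ b∈a → a#b (b∈a , gr∈letters b))
      (graphEdges-acyclic a linear-a) (graphEdges-acyclic b linear-b)

lemma8p3 : (n : ℕ) (m : Term n) → InM n m →
    InGbar (graphEdges m) × IsRoot (graphEdges m) (gr m)
lemma8p3 n m m∈Mₙ =
    ( ((λ u v → graphEdges-connected m (letter∈m u) (letter∈m v)) , graphEdges-acyclic m linear)
    , singleParent⇒avoidsPatterns (graphEdges-singleParent m linear))
  , isRoot (¬Arc-into-gr m linear) (λ v → Arc-into-nonRoot m linear (letter∈m v))
  where
    letter∈m : ∀ v → v ∈ letters m
    letter∈m v = ∈-resp-↭ (↭-sym m∈Mₙ) (∈-allFin v)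

    linear : Linear m
    linear = unique⇒linear m (Unique-resp-↭ (setoid (Fin n)) (↭⇒↭ₛ (↭-sym m∈Mₙ)) (allFin⁺ n))
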